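{- Let $i\in[n]$ and suppose that the $i$-th row is non-compact. Then for every $j\in[n]$, the probability (conditioned on row $i$ being non-compact) that $x_{i,j}$ survives $R_\epsilon$ is at most $1/n^{\epsilon}$; moreover this bound holds even after additionally conditioning on any choice of the affine subspace $A_{i-1}$.
   Context: Let $n=2^k$, $\mathbb{F}_n=\mathbb{F}_{2^k}$ with elements identified with $[n]$; variables $x_{i,j}$, $i,j\in[n]$, arranged in an $n\times n$ matrix whose $i$-th row is $\{x_{i,j}:j\in[n]\}$. Fix an $\mathbb{F}_2$-linear isomorphism $\phi:\mathbb{F}_{2^k}\to\mathbb{F}_2^k$, $[a]=\phi(a)$; for $f=\sum_{i<d}a_iZ^i$, $[f]\in\mathbb{F}_2^{kd}$ concatenates $[a_0],\dots,[a_{d-1}]$. For $i\in\mathbb{F}_n$, $\mathsf{Eval}_i$ is the $dk\times k$ matrix with $[f(i)]=[f]\cdot\mathsf{Eval}_i$, and $\overline{\mathsf{Eval}_i}$ is the $dk\times 2^k$ matrix of all $\mathbb{F}_2$-linear combinations of columns of $\mathsf{Eval}_i$. Procedure $R_\epsilon$ ($\epsilon k$ an integer): start with empty matrix $\mathcal{M}$ and empty vector $\mathcal{B}$ ($A_0=\mathbb{F}_2^{kd}$); for $i=1,\dots,n$, repeat $\epsilon k$ times: if all columns of $\overline{\mathsf{Eval}_i}$ lie in the column span of $\mathcal{M}$ do nothing, else pick a uniformly random column of $\overline{\mathsf{Eval}_i}$ outside that span and a uniformly random $b\in\mathbb{F}_2$ and append them to $\mathcal{M}$ and $\mathcal{B}$;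 then set $A_i=\{v\in\mathbb{F}_2^{kd}:v\mathcal{M}=\mathcal{B}\}$. Output $S_0=\{x_{i,j}:j\neq f(i)\ \forall f\text{ with }[f]\in A_n\}$. A variable survives if it is not in $S_0$. Row $i$ is compact if the columns of the final $\mathcal{M}$ span every column of $\mathsf{Eval}_i$, and non-compact otherwise. -}

module Defs where

open import Data.Bool using (Bool; true; false; _∧_; _∨_; _xor_; not; if_then_else_)
open import Data.Nat using (ℕ; zero; suc)
open import Data.Fin using (Fin; toℕ)
open import Data.List using (List; []; _∷_; _++_; map; length; foldr; concatMap)
open import Data.Bool.ListAction using (all; any)
open import Data.Vec using (Vec; []; _∷_; zipWith; replicate; tabulate; allFin)
import Data.Vec.Properties as VP
open import Data.Product using (_×_; _,_; proj₁; proj₂; Σ)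
open import Data.Rational using (ℚ; 0ℚ; 1ℚ; _+_; _*_; _/_)
open import Data.Integer using (+_)
open import Relation.Binary.PropositionalEquality using (_≡_; _≢_)
open import Relation.Nullary.Decidable using (⌊_⌋)
open import Algebra.Structures using (IsCommutativeRing)
open import Function.Bundles using (_⤖_)

-- F₂-vectors.  Via the fixed F₂-linear isomorphism φ we identify
-- 𝔽_{2^k} with F₂^k = Vec Bool k (so φ = id, field addition = xor).

Bits : ℕ → Set
Bits k = Vec Bool k

_⊕_ : ∀ {k} → Bits k → Bits k → Bits k
_⊕_ = zipWith _xor_

𝟘 : ∀ {k} → Bits k
𝟘 = replicate _ false

dot : ∀ {k} → Bits k → Bits k → Bool
dot u v = foldr _xor_ false (Data.Vec.toList (zipWith _∧_ u v))
  where import Data.Vec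

_=ᵇ_ : ∀ {k} → Bits k → Bits k → Bool
u =ᵇ v = ⌊ VP.≡-dec Data.Bool._≟_ u v ⌋
  where import Data.Bool

unit : ∀ {k} → Fin k → Bits k
unit c = tabulate (λ b → ⌊ b Data.Fin.≟ c ⌋)
  where import Data.Fin

allVec : ∀ {A : Set} → List A → (m : ℕ) → List (Vec A m)
allVec xs zero = [] ∷ []
allVec xs (suc m) = concatMap (λ x → map (x ∷_) (allVec xs m)) xs

bfilter : ∀ {A : Set} → (A → Bool) → List A → List A
bfilter p [] = []
bfilter p (x ∷ xs) = if p x then x ∷ bfilter p xs else bfilter p xs

allBits : (k : ℕ) → List (Bits k)
allBits = allVec (false ∷ true ∷ [])

-- A field structure on F₂^k with addition xor (i.e. 𝔽_{2^k} transported
-- along φ).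

record IsGF (k : ℕ) (mul : Bits k → Bits k → Bits k) (one : Bits k) : Set where
  field
    isCommRing : IsCommutativeRing _≡_ _⊕_ mul (λ x → x) 𝟘 one
    one≢zero   : one ≢ 𝟘
    inverse    : ∀ x → x ≢ 𝟘 → Σ (Bits k) (λ y → mul x y ≡ one)

-- Vectors of F₂^{kd}: a polynomial f = Σ_{t<d} a_t Z^t is represented by
-- [f] = ([a_0],…,[a_{d-1}]), stored as Vec (Bits k) d.

Big : ℕ → ℕ → Set
Big k d = Vec (Bits k) d

_⊕ᴮ_ : ∀ {k d} → Big k d → Big k d → Big k d
_⊕ᴮ_ = zipWith _⊕_

𝟘ᴮ : ∀ {k d} → Big k d
𝟘ᴮ = replicate _ 𝟘

dotᴮ : ∀ {k d} → Big k d → Big k d → Bool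
dotᴮ u v = foldr _xor_ false (Data.Vec.toList (zipWith dot u v))
  where import Data.Vec

_=ᴮ_ : ∀ {k d} → Big k d → Big k d → Bool
u =ᴮ v = ⌊ VP.≡-dec (VP.≡-dec Data.Bool._≟_) u v ⌋
  where import Data.Bool

allBig : (k d : ℕ) → List (Big k d)
allBig k d = allVec (allBits k) d

spanList : ∀ {k d} → List (Big k d) → List (Big k d)
spanList [] = 𝟘ᴮ ∷ []
spanList (c ∷ cs) = spanList cs ++ map (c ⊕ᴮ_) (spanList cs)

inSpan : ∀ {k d} → Big k d → List (Big k d) → Bool
inSpan v cs = any (v =ᴮ_) (spanList cs)

module Field {k : ℕ} (mul : Bits k → Bits k → Bits k) (one : Bits k) where

  pow : Bits k → ℕ → Bits k
  pow a zero = one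
  pow a (suc t) = mul a (pow a t)

  eval : ∀ {d} → Big k d → Bits k → Bits k
  eval [] a = 𝟘
  eval (c ∷ cs) a = c ⊕ mul a (eval cs a)

  -- column of \overline{Eval_a} indexed by s ∈ F₂^k: the unique column
  -- c_s with [f]·c_s = s·[f(a)] for all f (the F₂-combination with
  -- coefficients s of the k columns of Eval_a).
  colOf : ∀ {d} → Bits k → Bits k → Big k d
  colOf {d} a s = tabulate (λ t → tabulate (λ b → dot s (mul (unit b) (pow a (toℕ t)))))

  evalCols : ∀ {d} → Bits k → List (Big k d)
  evalCols a = Data.List.map (colOf a) (Data.List.tabulate unit)
    where import Data.List

  evalBarCols : ∀ {d} → Bits k → List (Big k d)
  evalBarCols a = map (colOf a) (allBits k)

Dist : Set → Set
Dist A = List (ℚ × A)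

return : ∀ {A} → A → Dist A
return x = (1ℚ , x) ∷ []

_>>=_ : ∀ {A B} → Dist A → (A → Dist B) → Dist B
μ >>= f = concatMap (λ { (p , x) → map (λ { (q , y) → (p * q , y) }) (f x) }) μ

uniform : ∀ {A} (x : A) (xs : List A) → Dist A
uniform x xs = map (λ y → ((+ 1) / length (x ∷ xs)) , y) (x ∷ xs)

Pr : ∀ {A} → Dist A → (A → Bool) → ℚ
Pr μ E = foldr (λ { (p , x) acc → if E x then p + acc else acc }) 0ℚ μ

-- The procedure R_ε.  A state is the pair (𝓜, 𝓑), stored as the list of
-- (column, bit) pairs appended so far.

State : ℕ → ℕ → Set
State k d = List (Big k d × Bool)

cols : ∀ {k d} → State k d → List (Big k d)
cols = map proj₁

-- v ∈ A  iff  v𝓜 = 𝓑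
satisfies : ∀ {k d} → State k d → Big k d → Bool
satisfies st v = all (λ { (c , b) → ⌊ dotᴮ v c Data.Bool.≟ b ⌋ }) st
  where import Data.Bool

module Procedure {k : ℕ} (d e : ℕ) (mul : Bits k → Bits k → Bits k) (one : Bits k)
                 (ι : Fin (Data.Nat._^_ 2 k) → Bits k) where
  open Field mul one

  step : Bits k → State k d → Dist (State k d)
  step a st with bfilter (λ c → not (inSpan c (cols st))) (evalBarCols {d} a)
  ... | [] = return st
  ... | c ∷ cs = uniform c cs >>= λ c' →
                 uniform true (false ∷ []) >>= λ b →
                 return (st ++ ((c' , b) ∷ []))

  stepRow : Bits k → ℕ → State k d → Dist (State k d)
  stepRow a zero st = return st
  stepRow a (suc m) st = step a st >>= stepRow a m

  runRows : List (Bits k) → State k d → Dist (State k d)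
  runRows [] st = return st
  runRows (a ∷ as) st = stepRow a e st >>= runRows as

  rows : List (Fin (Data.Nat._^_ 2 k))
  rows = Data.List.allFin _
    where import Data.List

  before : Fin (Data.Nat._^_ 2 k) → List (Bits k)
  before r = map ι (bfilter (λ r' → toℕ r' Data.Nat.<ᵇ toℕ r) rows)
    where import Data.Nat

  fromOn : Fin (Data.Nat._^_ 2 k) → List (Bits k)
  fromOn r = map ι (bfilter (λ r' → toℕ r Data.Nat.≤ᵇ toℕ r') rows)
    where import Data.Nat

  -- joint distribution of (state after rows 1..i-1, final state)
  joint : Fin (Data.Nat._^_ 2 k) → Dist (State k d × State k d)
  joint r = runRows (before r) [] >>= λ st →
            runRows (fromOn r) st >>= λ fin →
            return (st , fin)

  survives : State k d → Bits k → Bits k → Bool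
  survives fin a j = any (λ f → satisfies fin f ∧ (eval f a =ᵇ j)) (allBig k d)

  compact : State k d → Bits k → Bool
  compact fin a = all (λ c → inSpan c (cols fin)) (evalCols {d} a)

  sameSet : State k d → (Big k d → Bool) → Bool
  sameSet st A = all (λ v → ⌊ satisfies st v Data.Bool.≟ A v ⌋) (allBig k d)
    where import Data.Bool

module Submission where

-- Each of the e = εk repetitions for row a = ι r either finds every column of Eval‾_a already in
-- the span of 𝓜 (then row a is compact for good and counts in neither event), or appends a column
-- c_s of Eval‾_a together with a fair coin b.  A survivor f (satisfying all constraints, with
-- f(a) = j) forces b = s·[j], whereas whether row a ends up non-compact depends only on the columns
-- of 𝓜, not on the bits 𝓑.  So every repetition halves Pr[survive ∧ non-compact] relative to
-- Pr[non-compact], giving the factor 2^e = n^ε.  The rows processed before and after a only average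
-- this bound, which holds pointwise in the state after row i − 1, hence also conditioned on A_{i−1}.

open import Algebra.Structures using (IsCommutativeRing)
open import Data.Bool using (Bool; true; false; not; _∧_; _xor_; T)
open import Data.Bool.ListAction using (all)
open import Data.Bool.Properties using (xor-same; xor-identityʳ; ∧-zeroʳ; ∧-identityʳ; ∧-assoc; not-¬; T-∧; T-≡)
open import Data.Bool.Solver using (module xor-∧-Solver)
open import Data.Fin as Fin using (Fin; toℕ)
open import Data.Integer using (+_)
open import Data.List using (List; []; _∷_; _++_; map; length)
open import Data.List.Membership.Propositional using (_∈_; find)
open import Data.List.Membership.Propositional.Properties using (∈-++⁺ˡ; ∈-++⁺ʳ; ∈-++⁻; ∈-map⁺; ∈-map⁻; ∈-allFin)
open import Data.List.Properties using (++-assoc; ++-identityʳ; map-++)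
open import Data.List.Relation.Binary.Subset.Propositional using (_⊆_)
open import Data.List.Relation.Binary.Subset.Propositional.Properties using (Any-resp-⊆)
open import Data.List.Relation.Unary.All as All using (All; []; _∷_)
open import Data.List.Relation.Unary.All.Properties using (++⁺; all⁺; all⁻; anti-mono)
open import Data.List.Relation.Unary.Any using (here; there)
open import Data.List.Relation.Unary.Any.Properties using (any⁺; any⁻)
open import Data.Nat as ℕ using (ℕ; zero; suc; _^_)
import Data.Nat.Properties as ℕ
open import Data.Product using (∃; _×_; _,_; proj₁; proj₂)
open import Data.Rational using (ℚ; 0ℚ; 1ℚ; ½; _+_; _*_; _/_; _≤_; nonNegative)
import Data.Rational.Properties as ℚ
open import Data.Rational.Solver using (module +-*-Solver)
import Data.Integer.Properties as ℤ
import Data.Nat.Coprimality as Coprime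
open import Data.Sum using (inj₁; inj₂)
open import Data.Vec using ([]; _∷_; tabulate)
open import Data.Vec.Properties using (tabulate-cong)
open import Function using (id; _∘_; _∘′_; Equivalence)
open import Function.Bundles using (_⤖_; Bijection)
open import Relation.Binary.PropositionalEquality
open import Relation.Nullary using (yes; no)
open import Relation.Nullary.Decidable using (⌊_⌋; toWitness)
open import Relation.Nullary.Negation using (contradiction)

open import Defs

private variable A B : Set

-- Expectations over finite distributions

𝟙 : Bool → ℚ
𝟙 true = 1ℚ
𝟙 false = 0ℚ

𝔼 : Dist A → (A → ℚ) → ℚ
𝔼 [] g = 0ℚ
𝔼 ((p , x) ∷ μ) g = p * g x + 𝔼 μ g

Pr≡𝔼𝟙 : (μ : Dist A) (E : A → Bool) → Pr μ E ≡ 𝔼 μ (λ x → 𝟙 (E x))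
Pr≡𝔼𝟙 [] E = refl
Pr≡𝔼𝟙 ((p , x) ∷ μ) E with E x
... | true = cong₂ _+_ (sym (ℚ.*-identityʳ p)) (Pr≡𝔼𝟙 μ E)
... | false = trans (Pr≡𝔼𝟙 μ E) (sym (trans (cong (_+ _) (ℚ.*-zeroʳ p)) (ℚ.+-identityˡ _)))

𝔼-cong : (μ : Dist A) {g h : A → ℚ} → (∀ x → g x ≡ h x) → 𝔼 μ g ≡ 𝔼 μ h
𝔼-cong [] g≗h = refl
𝔼-cong ((p , x) ∷ μ) g≗h = cong₂ _+_ (cong (p *_) (g≗h x)) (𝔼-cong μ g≗h)

Pr-cong : (μ : Dist A) {E F : A → Bool} → (∀ x → E x ≡ F x) → Pr μ E ≡ Pr μ F
Pr-cong μ {E} {F} E≗F = begin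
  Pr μ E              ≡⟨ Pr≡𝔼𝟙 μ E ⟩
  𝔼 μ (λ x → 𝟙 (E x)) ≡⟨ 𝔼-cong μ (λ x → cong 𝟙 (E≗F x)) ⟩
  𝔼 μ (λ x → 𝟙 (F x)) ≡⟨ Pr≡𝔼𝟙 μ F ⟨
  Pr μ F              ∎
  where open ≡-Reasoning

𝔼-++ : (μ ν : Dist A) (g : A → ℚ) → 𝔼 (μ ++ ν) g ≡ 𝔼 μ g + 𝔼 ν g
𝔼-++ [] ν g = sym (ℚ.+-identityˡ _)
𝔼-++ ((p , x) ∷ μ) ν g = trans (cong (_+_ (p * g x)) (𝔼-++ μ ν g)) (sym (ℚ.+-assoc (p * g x) _ _))

-- _>>=_ reweights by an anonymous function, which can only be characterised extensionally.
𝔼-map-scale : (p : ℚ) (h : ℚ × A → ℚ × A) → (∀ q y → h (q , y) ≡ (p * q , y)) →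
              (μ : Dist A) (g : A → ℚ) → 𝔼 (map h μ) g ≡ p * 𝔼 μ g
𝔼-map-scale p h h≗ [] g = sym (ℚ.*-zeroʳ p)
𝔼-map-scale p h h≗ ((q , y) ∷ μ) g rewrite h≗ q y =
  trans (cong₂ _+_ (ℚ.*-assoc p q (g y)) (𝔼-map-scale p h h≗ μ g)) (sym (ℚ.*-distribˡ-+ p _ _))

𝔼-return : (x : A) (g : A → ℚ) → 𝔼 (return x) g ≡ g x
𝔼-return x g = trans (ℚ.+-identityʳ _) (ℚ.*-identityˡ _)

𝔼->>= : (μ : Dist A) (f : A → Dist B) (g : B → ℚ) → 𝔼 (μ >>= f) g ≡ 𝔼 μ (λ x → 𝔼 (f x) g)
𝔼->>= [] f g = refl
𝔼->>= ((p , x) ∷ μ) f g =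
  trans (𝔼-++ (map _ (f x)) (μ >>= f) g)
        (cong₂ _+_ (𝔼-map-scale p _ (λ q y → refl) (f x) g) (𝔼->>= μ f g))

𝔼->>=->>= : (μ : Dist A) (f : A → Dist B) (h : B → Dist B) (g : B → ℚ) →
            𝔼 ((μ >>= f) >>= h) g ≡ 𝔼 μ (λ x → 𝔼 (f x >>= h) g)
𝔼->>=->>= μ f h g = begin
  𝔼 ((μ >>= f) >>= h) g                ≡⟨ 𝔼->>= (μ >>= f) h g ⟩
  𝔼 (μ >>= f) (λ y → 𝔼 (h y) g)        ≡⟨ 𝔼->>= μ f _ ⟩
  𝔼 μ (λ x → 𝔼 (f x) (λ y → 𝔼 (h y) g)) ≡⟨ 𝔼-cong μ (λ x → 𝔼->>= (f x) h g) ⟨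
  𝔼 μ (λ x → 𝔼 (f x >>= h) g)          ∎
  where open ≡-Reasoning

coin : Dist Bool
coin = uniform true (false ∷ [])

𝔼-coin : (b : Bool) (g : Bool → ℚ) → 𝔼 coin g ≡ ½ * (g b + g (not b))
𝔼-coin true g = trans (cong (_+_ (½ * g true)) (ℚ.+-identityʳ (½ * g false)))
                      (sym (ℚ.*-distribˡ-+ ½ (g true) (g false)))
𝔼-coin false g = trans (𝔼-coin true g) (cong (½ *_) (ℚ.+-comm (g true) (g false)))

Supported : (A → Set) → Dist A → Set
Supported P = All (λ px → 0ℚ ≤ proj₁ px × P (proj₂ px))

Supported-weaken : {P Q : A → Set} → (∀ {x} → P x → Q x) → {μ : Dist A} → Supported P μ → Supported Q μ
Supported-weaken P⇒Q = All.map (λ (p≥0 , px) → p≥0 , P⇒Q px)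

Supported-return : {P : A → Set} {x : A} → P x → Supported P (return x)
Supported-return px = (ℚ.nonNegative⁻¹ 1ℚ , px) ∷ []

Supported-map-scale : {P : A → Set} (p : ℚ) (h : ℚ × A → ℚ × A) → (∀ q y → h (q , y) ≡ (p * q , y)) →
                      0ℚ ≤ p → (μ : Dist A) → Supported P μ → Supported P (map h μ)
Supported-map-scale p h h≗ p≥0 [] [] = []
Supported-map-scale p h h≗ p≥0 ((q , y) ∷ μ) ((q≥0 , py) ∷ sμ) rewrite h≗ q y =
  (ℚ.nonNegative⁻¹ _ {{ℚ.nonNeg*nonNeg⇒nonNeg p {{nonNegative p≥0}} q {{nonNegative q≥0}}}} , py)
  ∷ Supported-map-scale p h h≗ p≥0 μ sμ

Supported->>= : {P : A → Set} {Q : B → Set} (μ : Dist A) (f : A → Dist B) →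
                Supported P μ → (∀ x → P x → Supported Q (f x)) → Supported Q (μ >>= f)
Supported->>= [] f [] sf = []
Supported->>= ((p , x) ∷ μ) f ((p≥0 , px) ∷ sμ) sf =
  ++⁺ (Supported-map-scale p _ (λ q y → refl) p≥0 (f x) (sf x px)) (Supported->>= μ f sμ sf)

Supported-uniform : {A : Set} (x : A) (xs : List A) → Supported (_∈ x ∷ xs) (uniform x xs)
Supported-uniform {A} x xs = weighted (x ∷ xs) id
  where
  w : ℚ
  w = (+ 1) / length (x ∷ xs)
  weighted : (ys : List A) → (∀ {y} → y ∈ ys → y ∈ x ∷ xs) → Supported (_∈ x ∷ xs) (map (λ y → w , y) ys)
  weighted [] _ = []
  weighted (y ∷ ys) ys⊆ = (ℚ.nonNegative⁻¹ w {{ℚ.normalize-nonNeg 1 (length (x ∷ xs))}} , ys⊆ (here refl))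
                          ∷ weighted ys (ys⊆ ∘ there)

𝔼-vanishes : {μ : Dist A} {g : A → ℚ} → Supported (λ x → g x ≡ 0ℚ) μ → 𝔼 μ g ≡ 0ℚ
𝔼-vanishes [] = refl
𝔼-vanishes {μ = (p , x) ∷ μ} ((_ , gx≡0) ∷ sμ) rewrite gx≡0 | 𝔼-vanishes sμ | ℚ.*-zeroʳ p = refl

𝔼-*-mono : {μ : Dist A} {g h : A → ℚ} (c : ℚ) → Supported (λ x → g x * c ≤ h x) μ → 𝔼 μ g * c ≤ 𝔼 μ h
𝔼-*-mono c [] = ℚ.≤-reflexive (ℚ.*-zeroˡ c)
𝔼-*-mono {μ = (p , x) ∷ μ} {g} c ((p≥0 , gc≤h) ∷ sμ) =
  subst (_≤ _) (sym (trans (ℚ.*-distribʳ-+ c (p * g x) _) (cong (_+ (𝔼 μ g * c)) (ℚ.*-assoc p (g x) c))))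
    (ℚ.+-mono-≤ (ℚ.*-monoˡ-≤-nonNeg p {{nonNegative p≥0}} gc≤h) (𝔼-*-mono c sμ))

pow₂ : ℕ → ℚ
pow₂ m = (+ (2 ^ m)) / 1

pow₂-suc : ∀ m → pow₂ (suc m) ≡ (+ 2) / 1 * pow₂ m
pow₂-suc m = trans (cong (_/ 1) (ℤ.pos-* 2 (2 ^ m)))
                   (cong ((+ 2) / 1 *_) (sym (ℚ.normalize-coprime (Coprime.sym (Coprime.1-coprimeTo (2 ^ m))))))

halve-≤ : ∀ x y Q → x * Q ≤ y → ½ * (x + 0ℚ) * ((+ 2) / 1 * Q) ≤ ½ * (y + y)
halve-≤ x y Q xQ≤y = subst₂ _≤_
  (solve 2 (λ x Q → x :* Q := con ½ :* (x :+ con 0ℚ) :* (con ((+ 2) / 1) :* Q)) refl x Q)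
  (solve 1 (λ y → y := con ½ :* (y :+ y)) refl y)
  xQ≤y
  where open +-*-Solver

-- Additive functionals on F₂ⁿ and the columns of Eval‾

dot-⊕ : ∀ {n} (s x y : Bits n) → dot s (x ⊕ y) ≡ dot s x xor dot s y
dot-⊕ [] [] [] = refl
dot-⊕ (a ∷ s) (b ∷ x) (c ∷ y) rewrite dot-⊕ s x y =
  solve 5 (λ a b c p q → (a :* (b :+ c)) :+ (p :+ q) := ((a :* b) :+ p) :+ ((a :* c) :+ q)) refl
    a b c (dot s x) (dot s y)
  where open xor-∧-Solver

⊕-𝟘ˡ : ∀ {n} (x : Bits n) → 𝟘 ⊕ x ≡ x
⊕-𝟘ˡ [] = refl
⊕-𝟘ˡ (a ∷ x) = cong (a ∷_) (⊕-𝟘ˡ x)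

IsAdditive : ∀ {n} → (Bits n → Bool) → Set
IsAdditive L = ∀ x y → L (x ⊕ y) ≡ L x xor L y

additive-𝟘 : ∀ {n} (L : Bits n → Bool) → IsAdditive L → L 𝟘 ≡ false
additive-𝟘 L add = begin
  L 𝟘           ≡⟨ cong L (⊕-𝟘ˡ 𝟘) ⟨
  L (𝟘 ⊕ 𝟘)     ≡⟨ add 𝟘 𝟘 ⟩
  L 𝟘 xor L 𝟘   ≡⟨ xor-same (L 𝟘) ⟩
  false         ∎
  where open ≡-Reasoning

unit-zero : ∀ {n} → unit {suc n} Fin.zero ≡ true ∷ 𝟘
unit-zero {n} = cong (true ∷_) (all-false n)
  where
  all-false : ∀ n → tabulate {n = n} (λ _ → false) ≡ 𝟘
  all-false zero = refl
  all-false (suc n) = cong (false ∷_) (all-false n)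

unit-suc : ∀ {n} (b : Fin n) → unit (Fin.suc b) ≡ false ∷ unit b
unit-suc b = cong (false ∷_) (tabulate-cong λ b′ → ≟-suc b′)
  where
  ≟-suc : ∀ b′ → ⌊ Fin.suc b′ Fin.≟ Fin.suc b ⌋ ≡ ⌊ b′ Fin.≟ b ⌋
  ≟-suc b′ with b′ Fin.≟ b
  ... | yes _ = refl
  ... | no _ = refl

dot-tabulate-unit : ∀ {n} (L : Bits n → Bool) → IsAdditive L → ∀ x → dot x (tabulate (L ∘ unit)) ≡ L x
dot-tabulate-unit {zero} L add [] = sym (additive-𝟘 L add)
dot-tabulate-unit {suc n} L add (a ∷ x) = begin
  (a ∧ L (unit Fin.zero)) xor dot x (tabulate (L ∘ unit ∘ Fin.suc))
    ≡⟨ cong₂ (λ u v → (a ∧ L u) xor dot x v) unit-zero (tabulate-cong (cong L ∘ unit-suc)) ⟩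
  (a ∧ L (true ∷ 𝟘)) xor dot x (tabulate (L′ ∘ unit))
    ≡⟨ cong₂ _xor_ (head-term a) (dot-tabulate-unit L′ (λ u v → add (false ∷ u) (false ∷ v)) x) ⟩
  L (a ∷ 𝟘) xor L (false ∷ x)
    ≡⟨ add (a ∷ 𝟘) (false ∷ x) ⟨
  L ((a xor false) ∷ (𝟘 ⊕ x))
    ≡⟨ cong₂ (λ u v → L (u ∷ v)) (xor-identityʳ a) (⊕-𝟘ˡ x) ⟩
  L (a ∷ x) ∎
  where
  open ≡-Reasoning
  L′ : Bits n → Bool
  L′ u = L (false ∷ u)
  head-term : ∀ a → (a ∧ L (true ∷ 𝟘)) ≡ L (a ∷ 𝟘)
  head-term true = refl
  head-term false = sym (additive-𝟘 L add)

module _ {k : ℕ} {mul : Bits k → Bits k → Bits k} {one : Bits k} (gf : IsGF k mul one) where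
  open Field mul one
  open IsCommutativeRing (IsGF.isCommRing gf)
    using (distribˡ; distribʳ; *-assoc; *-comm; *-identityʳ)

  -- Generalised from λ′ = dot s (i.e. colOf a s) so that the induction goes through: dropping the
  -- constant coefficient replaces λ′ by λ′ ∘ (a *_).
  dotᴮ-tabulate-pow : ∀ {d} (a : Bits k) (λ′ : Bits k → Bool) → IsAdditive λ′ → (f : Big k d) →
    dotᴮ f (tabulate λ t → tabulate λ b → λ′ (mul (unit b) (pow a (toℕ t)))) ≡ λ′ (eval f a)
  dotᴮ-tabulate-pow a λ′ add [] = sym (additive-𝟘 λ′ add)
  dotᴮ-tabulate-pow a λ′ add (c ∷ f) = begin
    dot c (tabulate λ b → λ′ (mul (unit b) one))
      xor dotᴮ f (tabulate λ t → tabulate λ b → λ′ (mul (unit b) (mul a (pow a (toℕ t)))))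
      ≡⟨ cong₂ _xor_ (dot-tabulate-unit (λ x → λ′ (mul x one)) additive-*one c)
                     (cong (dotᴮ f) (tabulate-cong λ t → tabulate-cong λ b → cong λ′ (swap (unit b) (pow a (toℕ t))))) ⟩
    λ′ (mul c one) xor dotᴮ f (tabulate λ t → tabulate λ b → λ′ (mul a (mul (unit b) (pow a (toℕ t)))))
      ≡⟨ cong₂ _xor_ (cong λ′ (*-identityʳ c))
                     (dotᴮ-tabulate-pow a (λ x → λ′ (mul a x)) additive-a* f) ⟩
    λ′ c xor λ′ (mul a (eval f a))
      ≡⟨ add c (mul a (eval f a)) ⟨
    λ′ (eval (c ∷ f) a) ∎
    where
    open ≡-Reasoning
    additive-*one : IsAdditive (λ x → λ′ (mul x one))
    additive-*one x y = trans (cong λ′ (distribʳ one x y)) (add (mul x one) (mul y one))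
    additive-a* : IsAdditive (λ x → λ′ (mul a x))
    additive-a* x y = trans (cong λ′ (distribˡ a x y)) (add (mul a x) (mul a y))
    swap : ∀ x y → mul x (mul a y) ≡ mul a (mul x y)
    swap x y = begin
      mul x (mul a y) ≡⟨ *-assoc x a y ⟨
      mul (mul x a) y ≡⟨ cong (λ z → mul z y) (*-comm x a) ⟩
      mul (mul a x) y ≡⟨ *-assoc a x y ⟩
      mul a (mul x y) ∎

  dotᴮ-colOf : ∀ {d} (a s : Bits k) (f : Big k d) → dotᴮ f (colOf a s) ≡ dot s (eval f a)
  dotᴮ-colOf a s = dotᴮ-tabulate-pow a (dot s) (dot-⊕ s)


-- Lists and column spans

∈-bfilter⁻ : (p : A → Bool) {x : A} (xs : List A) → x ∈ bfilter p xs → x ∈ xs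
∈-bfilter⁻ p (y ∷ xs) x∈ with p y
∈-bfilter⁻ p (y ∷ xs) (here x≡y) | true = here x≡y
∈-bfilter⁻ p (y ∷ xs) (there x∈) | true = there (∈-bfilter⁻ p xs x∈)
... | false = there (∈-bfilter⁻ p xs x∈)

∈-bfilter⁺ : (p : A → Bool) (xs : List A) {x : A} → x ∈ xs → T (p x) → x ∈ bfilter p xs
∈-bfilter⁺ p (y ∷ xs) (here refl) px with p y
... | true = here refl
∈-bfilter⁺ p (y ∷ xs) (there x∈) px with p y
... | true = there (∈-bfilter⁺ p xs x∈ px)
... | false = ∈-bfilter⁺ p xs x∈ px

bfilter-≡[] : (p : A → Bool) (xs : List A) → bfilter p xs ≡ [] → All (λ x → p x ≡ false) xs
bfilter-≡[] p [] _ = []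
bfilter-≡[] p (y ∷ xs) eq with p y in py
... | false = py ∷ bfilter-≡[] p xs eq

not≡false⇒T : ∀ {b} → not b ≡ false → T b
not≡false⇒T {true} _ = _

∈-allBits : ∀ {n} (v : Bits n) → v ∈ allBits n
∈-allBits [] = here refl
∈-allBits (false ∷ v) = ∈-++⁺ˡ (∈-map⁺ (false ∷_) (∈-allBits v))
∈-allBits {suc n} (true ∷ v) = ∈-++⁺ʳ (map (false ∷_) (allBits n)) (∈-++⁺ˡ (∈-map⁺ (true ∷_) (∈-allBits v)))

module _ {k d : ℕ} where

  𝟘ᴮ∈spanList : (cs : List (Big k d)) → 𝟘ᴮ ∈ spanList cs
  𝟘ᴮ∈spanList [] = here refl
  𝟘ᴮ∈spanList (c ∷ cs) = ∈-++⁺ˡ (𝟘ᴮ∈spanList cs)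

  spanList-++ : (cs ds : List (Big k d)) → spanList cs ⊆ spanList (cs ++ ds)
  spanList-++ [] ds (here refl) = 𝟘ᴮ∈spanList ds
  spanList-++ (c ∷ cs) ds u∈ with ∈-++⁻ (spanList cs) u∈
  ... | inj₁ u∈cs = ∈-++⁺ˡ (spanList-++ cs ds u∈cs)
  ... | inj₂ u∈c+cs with ∈-map⁻ (c ⊕ᴮ_) u∈c+cs
  ...   | v , v∈cs , refl = ∈-++⁺ʳ (spanList (cs ++ ds)) (∈-map⁺ (c ⊕ᴮ_) (spanList-++ cs ds v∈cs))

  inSpan-++ : (v : Big k d) (cs ds : List (Big k d)) → T (inSpan v cs) → T (inSpan v (cs ++ ds))
  inSpan-++ v cs ds = any⁺ (v =ᴮ_) ∘′ Any-resp-⊆ (spanList-++ cs ds) ∘′ any⁻ (v =ᴮ_) (spanList cs)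

-- The procedure R_ε

module Survival {k : ℕ} (d e : ℕ) {mul : Bits k → Bits k → Bits k} {one : Bits k}
                (gf : IsGF k mul one) (ι : Fin (2 ^ k) → Bits k) where
  open Procedure d e mul one ι
  open Field mul one

  St : Set
  St = State k d

  Kernel : Set
  Kernel = St → Dist St

  _>=>_ : Kernel → Kernel → Kernel
  (F >=> G) x = F x >>= G

  _⊑_ : St → St → Set
  x ⊑ z = ∃ λ w → z ≡ x ++ w

  Extending : Kernel → Set
  Extending K = ∀ x → Supported (x ⊑_) (K x)

  ColsInvariant : (St → ℚ) → Set
  ColsInvariant g = ∀ {x y} → cols x ≡ cols y → g x ≡ g y

  ColsInvariantKernel : Kernel → Set
  ColsInvariantKernel K = ∀ g → ColsInvariant g → ColsInvariant (λ x → 𝔼 (K x) g)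

  snoc : St → Big k d → Bool → St
  snoc x c b = x ++ ((c , b) ∷ [])

  freshCols : Bits k → List (Big k d) → List (Big k d)
  freshCols a cs = bfilter (λ c → not (inSpan c cs)) (evalBarCols a)

  stepFrom : St → List (Big k d) → Dist St
  stepFrom x [] = return x
  stepFrom x (c ∷ cs) = uniform c cs >>= λ c′ → coin >>= λ b → return (snoc x c′ b)

  step≡stepFrom : ∀ a x → step a x ≡ stepFrom x (freshCols a (cols x))
  step≡stepFrom a x with freshCols a (cols x)
  ... | [] = refl
  ... | c ∷ cs = refl

  𝔼-stepFrom : ∀ x c cs (g : St → ℚ) →
    𝔼 (stepFrom x (c ∷ cs)) g ≡ 𝔼 (uniform c cs) (λ c′ → 𝔼 coin (λ b → g (snoc x c′ b)))
  𝔼-stepFrom x c cs g = trans (𝔼->>= (uniform c cs) (λ c′ → coin >>= λ b → return (snoc x c′ b)) g)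
    (𝔼-cong (uniform c cs) λ c′ → trans (𝔼->>= coin (λ b → return (snoc x c′ b)) g)
      (𝔼-cong coin λ b → 𝔼-return (snoc x c′ b) g))

  cols-snoc : ∀ x c b → cols (snoc x c b) ≡ cols x ++ (c ∷ [])
  cols-snoc x c b = map-++ proj₁ x ((c , b) ∷ [])

  extending-return : Extending return
  extending-return x = Supported-return ([] , sym (++-identityʳ x))

  extending->=> : ∀ {F G} → Extending F → Extending G → Extending (F >=> G)
  extending->=> {F} {G} extF extG x = Supported->>= (F x) G (extF x) λ where
    _ (w , refl) → Supported-weaken (λ (w′ , eq) → w ++ w′ , trans eq (++-assoc x w w′)) (extG (x ++ w))

  extending-step : ∀ a → Extending (step a)
  extending-step a x rewrite step≡stepFrom a x = from (freshCols a (cols x))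
    where
    from : ∀ cs → Supported (x ⊑_) (stepFrom x cs)
    from [] = extending-return x
    from (c ∷ cs) = Supported->>= (uniform c cs) (λ c′ → coin >>= λ b → return (snoc x c′ b)) (Supported-uniform c cs)
      λ c′ _ → Supported->>= coin (λ b → return (snoc x c′ b)) (Supported-uniform true (false ∷ []))
      λ b _ → Supported-return (_ , refl)

  extending-stepRow : ∀ a m → Extending (stepRow a m)
  extending-stepRow a zero = extending-return
  extending-stepRow a (suc m) = extending->=> (extending-step a) (extending-stepRow a m)

  extending-runRows : ∀ as → Extending (runRows as)
  extending-runRows [] = extending-return
  extending-runRows (b ∷ bs) = extending->=> (extending-stepRow b e) (extending-runRows bs)

  invariant-return : ColsInvariantKernel return
  invariant-return g inv {x} {y} eq = trans (𝔼-return x g) (trans (inv eq) (sym (𝔼-return y g)))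

  invariant->=> : ∀ {F G} → ColsInvariantKernel F → ColsInvariantKernel G → ColsInvariantKernel (F >=> G)
  invariant->=> {F} {G} invF invG g inv {x} {y} eq =
    trans (𝔼->>= (F x) G g) (trans (invF _ (invG g inv) eq) (sym (𝔼->>= (F y) G g)))

  invariant-step : ∀ a → ColsInvariantKernel (step a)
  invariant-step a g inv {x} {y} eq
    rewrite step≡stepFrom a x | step≡stepFrom a y | eq = from (freshCols a (cols y))
    where
    from : ∀ cs → 𝔼 (stepFrom x cs) g ≡ 𝔼 (stepFrom y cs) g
    from [] = invariant-return g inv eq
    from (c ∷ cs) = trans (𝔼-stepFrom x c cs g) (trans
      (𝔼-cong (uniform c cs) λ c′ → 𝔼-cong coin λ b →
        inv (trans (cols-snoc x c′ b) (trans (cong (_++ _) eq) (sym (cols-snoc y c′ b)))))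
      (sym (𝔼-stepFrom y c cs g)))

  invariant-stepRow : ∀ a m → ColsInvariantKernel (stepRow a m)
  invariant-stepRow a zero = invariant-return
  invariant-stepRow a (suc m) = invariant->=> {step a} (invariant-step a) (invariant-stepRow a m)

  invariant-runRows : ∀ as → ColsInvariantKernel (runRows as)
  invariant-runRows [] = invariant-return
  invariant-runRows (b ∷ bs) = invariant->=> {stepRow b e} (invariant-stepRow b e) (invariant-runRows bs)

  freshCols-≡[] : ∀ a cs → freshCols a cs ≡ [] → All (λ c → T (inSpan c cs)) (evalBarCols a)
  freshCols-≡[] a cs eq = All.map not≡false⇒T (bfilter-≡[] _ (evalBarCols a) eq)

  ∈-freshCols⁻ : ∀ a cs {c} → c ∈ freshCols a cs → ∃ λ s → c ≡ colOf a s
  ∈-freshCols⁻ a cs c∈ with ∈-map⁻ (colOf a) (∈-bfilter⁻ _ (evalBarCols a) c∈)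
  ... | s , _ , c≡ = s , c≡

  evalCols⊆evalBarCols : ∀ a {c} → c ∈ evalCols {d} a → c ∈ evalBarCols a
  evalCols⊆evalBarCols a c∈ with ∈-map⁻ (colOf a) c∈
  ... | s , _ , refl = ∈-map⁺ (colOf a) (∈-allBits s)

  compact-⊑ : ∀ a {x z} → All (λ c → T (inSpan c (cols x))) (evalBarCols a) → x ⊑ z → T (compact z a)
  compact-⊑ a {x} spanned (w , refl) = all⁻ _ (All.map
    (λ {c} c∈span → subst (T ∘ inSpan c) (sym (map-++ proj₁ x w)) (inSpan-++ c (cols x) (cols w) c∈span))
    (anti-mono (evalCols⊆evalBarCols a) spanned))

  survives-colOf : ∀ {z a j s b} → T (survives z a j) → (colOf a s , b) ∈ z → b ≡ dot s j
  survives-colOf {z} {a} {j} {s} {b} surv c∈ with find (any⁻ _ (allBig k d) surv)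
  ... | f , _ , sat∧eval with Equivalence.to T-∧ sat∧eval
  ...   | sat , eval≡ = begin
    b                    ≡⟨ toWitness (All.lookup (all⁺ _ z sat) c∈) ⟨
    dotᴮ f (colOf a s)   ≡⟨ dotᴮ-colOf gf a s f ⟩
    dot s (eval f a)     ≡⟨ cong (dot s) (toWitness eval≡) ⟩
    dot s j              ∎
    where open ≡-Reasoning

  module _ (a j : Bits k) where

    nonCompact : St → Bool
    nonCompact z = not (compact z a)

    isSurvivor : St → Bool
    isSurvivor z = survives z a j ∧ nonCompact z

    SurvivalBound : ℚ → Kernel → Set
    SurvivalBound Q K = ∀ x → 𝔼 (K x) (𝟙 ∘ isSurvivor) * Q ≤ 𝔼 (K x) (𝟙 ∘ nonCompact)

    nonCompact-invariant : ColsInvariant (𝟙 ∘ nonCompact)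
    nonCompact-invariant eq = cong (λ cs → 𝟙 (not (all (λ c → inSpan c cs) (evalCols a)))) eq

    𝟙-isSurvivor≤𝟙-nonCompact : ∀ z → 𝟙 (isSurvivor z) * 1ℚ ≤ 𝟙 (nonCompact z)
    𝟙-isSurvivor≤𝟙-nonCompact z with survives z a j | nonCompact z
    ... | true  | true  = ℚ.≤-refl
    ... | true  | false = ℚ.≤-refl
    ... | false | true  = ℚ.nonNegative⁻¹ 1ℚ
    ... | false | false = ℚ.≤-refl

    compact⇒𝟙-isSurvivor≡0 : ∀ {z} → T (compact z a) → 𝟙 (isSurvivor z) ≡ 0ℚ
    compact⇒𝟙-isSurvivor≡0 {z} comp rewrite Equivalence.to T-≡ comp | ∧-zeroʳ (survives z a j) = refl

    compact⇒𝟙-nonCompact≡0 : ∀ {z} → T (compact z a) → 𝟙 (nonCompact z) ≡ 0ℚ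
    compact⇒𝟙-nonCompact≡0 comp rewrite Equivalence.to T-≡ comp = refl

    wrongBit⇒𝔼-isSurvivor≡0 : ∀ {K} → Extending K → ∀ x s →
      𝔼 (K (snoc x (colOf a s) (not (dot s j)))) (𝟙 ∘ isSurvivor) ≡ 0ℚ
    wrongBit⇒𝔼-isSurvivor≡0 {K} extK x s = 𝔼-vanishes (Supported-weaken killed (extK _))
      where
      killed : ∀ {z} → snoc x (colOf a s) (not (dot s j)) ⊑ z → 𝟙 (isSurvivor z) ≡ 0ℚ
      killed {z} (w , refl) with survives z a j in surv
      ... | false = refl
      ... | true = contradiction
        (survives-colOf {s = s} (Equivalence.from T-≡ surv) (∈-++⁺ˡ (∈-++⁺ʳ x (here refl))))
        (not-¬ refl ∘ sym)

    survivalBound-cong : ∀ {Q K K′} → (∀ x g → 𝔼 (K x) g ≡ 𝔼 (K′ x) g) →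
      SurvivalBound Q K → SurvivalBound Q K′
    survivalBound-cong K≈K′ bound x = subst₂ (λ u v → u * _ ≤ v) (K≈K′ x _) (K≈K′ x _) (bound x)

    survivalBound-extending : ∀ {K} → Extending K → SurvivalBound 1ℚ K
    survivalBound-extending extK x = 𝔼-*-mono 1ℚ
      (Supported-weaken (λ {z} _ → 𝟙-isSurvivor≤𝟙-nonCompact z) (extK x))

    survivalBound->=> : ∀ {F K Q} → Extending F → SurvivalBound Q K → SurvivalBound Q (F >=> K)
    survivalBound->=> {F} {K} {Q} extF bound x =
      subst₂ (λ u v → u * Q ≤ v) (sym (𝔼->>= (F x) K _)) (sym (𝔼->>= (F x) K _))
        (𝔼-*-mono Q (Supported-weaken (λ {y} _ → bound y) (extF x)))

    survivalBound-coin : ∀ {Q K} → Extending K → ColsInvariantKernel K → SurvivalBound Q K → ∀ x s →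
      𝔼 coin (λ b → 𝔼 (K (snoc x (colOf a s) b)) (𝟙 ∘ isSurvivor)) * ((+ 2) / 1 * Q)
        ≤ 𝔼 coin (λ b → 𝔼 (K (snoc x (colOf a s) b)) (𝟙 ∘ nonCompact))
    survivalBound-coin {Q} {K} extK invK bound x s = begin
      𝔼 coin (ψ S) * 2Q                  ≡⟨ cong (_* 2Q) (𝔼-coin b₀ (ψ S)) ⟩
      ½ * (ψ S b₀ + ψ S (not b₀)) * 2Q   ≡⟨ cong (λ t → ½ * (ψ S b₀ + t) * 2Q) (wrongBit⇒𝔼-isSurvivor≡0 {K} extK x s) ⟩
      ½ * (ψ S b₀ + 0ℚ) * 2Q             ≤⟨ halve-≤ (ψ S b₀) (ψ N b₀) Q (bound (snoc x (colOf a s) b₀)) ⟩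
      ½ * (ψ N b₀ + ψ N b₀)              ≡⟨ cong (λ t → ½ * (ψ N b₀ + t)) bit-irrelevant ⟩
      ½ * (ψ N b₀ + ψ N (not b₀))        ≡⟨ 𝔼-coin b₀ (ψ N) ⟨
      𝔼 coin (ψ N)                       ∎
      where
      open ℚ.≤-Reasoning
      S N : St → ℚ
      S = 𝟙 ∘ isSurvivor
      N = 𝟙 ∘ nonCompact
      2Q : ℚ
      2Q = (+ 2) / 1 * Q
      b₀ : Bool
      b₀ = dot s j
      ψ : (St → ℚ) → Bool → ℚ
      ψ g b = 𝔼 (K (snoc x (colOf a s) b)) g
      bit-irrelevant : ψ N b₀ ≡ ψ N (not b₀)
      bit-irrelevant = invK N nonCompact-invariant
        (trans (cols-snoc x (colOf a s) b₀) (sym (cols-snoc x (colOf a s) (not b₀))))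

    spanned⇒𝔼≡0 : ∀ {K} → Extending K → ∀ {x} → All (λ c → T (inSpan c (cols x))) (evalBarCols a) →
      ∀ {g} → (∀ {z} → T (compact z a) → g z ≡ 0ℚ) → 𝔼 (K x) g ≡ 0ℚ
    spanned⇒𝔼≡0 extK {x} spanned vanish =
      𝔼-vanishes (Supported-weaken (λ {z} x⊑z → vanish {z} (compact-⊑ a spanned x⊑z)) (extK x))

    survivalBound-step : ∀ {Q K} → Extending K → ColsInvariantKernel K → SurvivalBound Q K →
      SurvivalBound ((+ 2) / 1 * Q) (step a >=> K)
    survivalBound-step {Q} {K} extK invK bound x =
      subst₂ (λ u v → u * 2Q ≤ v) (sym (𝔼->>= (step a x) K _)) (sym (𝔼->>= (step a x) K _))
        (subst (λ μ → 𝔼 μ (ψ (𝟙 ∘ isSurvivor)) * 2Q ≤ 𝔼 μ (ψ (𝟙 ∘ nonCompact)))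
          (sym (step≡stepFrom a x)) (from (freshCols a (cols x)) refl))
      where
      2Q : ℚ
      2Q = (+ 2) / 1 * Q
      ψ : (St → ℚ) → St → ℚ
      ψ g y = 𝔼 (K y) g
      from : ∀ cs → freshCols a (cols x) ≡ cs →
        𝔼 (stepFrom x cs) (ψ (𝟙 ∘ isSurvivor)) * 2Q ≤ 𝔼 (stepFrom x cs) (ψ (𝟙 ∘ nonCompact))
      from [] fresh≡[] = subst₂ (λ u v → u * 2Q ≤ v)
        (sym (trans (𝔼-return x (ψ (𝟙 ∘ isSurvivor))) (spanned⇒𝔼≡0 extK spanned (λ {z} → compact⇒𝟙-isSurvivor≡0 {z}))))
        (sym (trans (𝔼-return x (ψ (𝟙 ∘ nonCompact))) (spanned⇒𝔼≡0 extK spanned (λ {z} → compact⇒𝟙-nonCompact≡0 {z}))))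
        (ℚ.≤-reflexive (ℚ.*-zeroˡ 2Q))
        where spanned = freshCols-≡[] a (cols x) fresh≡[]
      from (c ∷ cs) fresh≡ = subst₂ (λ u v → u * 2Q ≤ v) (sym (𝔼-stepFrom x c cs _)) (sym (𝔼-stepFrom x c cs _))
        (𝔼-*-mono 2Q (Supported-weaken column-bound (Supported-uniform c cs)))
        where
        column-bound : ∀ {c′} → c′ ∈ c ∷ cs →
          𝔼 coin (λ b → ψ (𝟙 ∘ isSurvivor) (snoc x c′ b)) * 2Q ≤ 𝔼 coin (λ b → ψ (𝟙 ∘ nonCompact) (snoc x c′ b))
        column-bound {c′} c′∈ with ∈-freshCols⁻ a (cols x) (subst (c′ ∈_) (sym fresh≡) c′∈)
        ... | s , refl = survivalBound-coin extK invK bound x s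

    survivalBound-stepRow : ∀ m {K} → Extending K → ColsInvariantKernel K →
      SurvivalBound (pow₂ m) (stepRow a m >=> K)
    survivalBound-stepRow zero {K} extK invK =
      survivalBound-cong {K = K} {K′ = stepRow a zero >=> K}
        (λ x g → sym (trans (𝔼->>= (return x) K g) (𝔼-return x (λ y → 𝔼 (K y) g))))
        (survivalBound-extending extK)
    survivalBound-stepRow (suc m) {K} extK invK =
      subst (λ Q → SurvivalBound Q (stepRow a (suc m) >=> K)) (sym (pow₂-suc m))
      (survivalBound-cong {K = step a >=> (stepRow a m >=> K)} {K′ = stepRow a (suc m) >=> K}
        (λ x g → trans (𝔼->>= (step a x) (stepRow a m >=> K) g) (sym (𝔼->>=->>= (step a x) (stepRow a m) K g)))
        (survivalBound-step (extending->=> (extending-stepRow a m) extK)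
          (invariant->=> {stepRow a m} (invariant-stepRow a m) invK) (survivalBound-stepRow m extK invK)))

    survivalBound-runRows : ∀ as → a ∈ as → SurvivalBound (pow₂ e) (runRows as)
    survivalBound-runRows (b ∷ bs) (here refl) =
      survivalBound-stepRow e (extending-runRows bs) (invariant-runRows bs)
    survivalBound-runRows (b ∷ bs) (there a∈) =
      survivalBound->=> (extending-stepRow b e) (survivalBound-runRows bs a∈)

  Pr-joint : ∀ r (E : St × St → Bool) → Pr (joint r) E ≡
    𝔼 (runRows (before r) []) (λ st → 𝔼 (runRows (fromOn r) st) (λ fin → 𝟙 (E (st , fin))))
  Pr-joint r E = begin
    Pr (joint r) E
      ≡⟨ Pr≡𝔼𝟙 (joint r) E ⟩
    𝔼 (joint r) (𝟙 ∘ E)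
      ≡⟨ 𝔼->>= (runRows (before r) []) (λ st → runRows (fromOn r) st >>= λ fin → return (st , fin)) (𝟙 ∘ E) ⟩
    𝔼 (runRows (before r) []) (λ st → 𝔼 (runRows (fromOn r) st >>= λ fin → return (st , fin)) (𝟙 ∘ E))
      ≡⟨ 𝔼-cong (runRows (before r) []) (λ st →
           trans (𝔼->>= (runRows (fromOn r) st) (λ fin → return (st , fin)) (𝟙 ∘ E))
                 (𝔼-cong (runRows (fromOn r) st) λ fin → 𝔼-return (st , fin) (𝟙 ∘ E))) ⟩
    𝔼 (runRows (before r) []) (λ st → 𝔼 (runRows (fromOn r) st) (λ fin → 𝟙 (E (st , fin))))
      ∎
    where open ≡-Reasoning

  ι∈fromOn : ∀ r → ι r ∈ fromOn r
  ι∈fromOn r = ∈-map⁺ ι (∈-bfilter⁺ _ rows (∈-allFin r) (ℕ.≤⇒≤ᵇ (ℕ.≤-refl {toℕ r})))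

  survivalBound-joint : ∀ r j (Q : St → Bool) →
    Pr (joint r) (λ (st , fin) → isSurvivor (ι r) j fin ∧ Q st) * pow₂ e
      ≤ Pr (joint r) (λ (st , fin) → nonCompact (ι r) j fin ∧ Q st)
  survivalBound-joint r j Q = subst₂ (λ u v → u * pow₂ e ≤ v) (sym (Pr-joint r _)) (sym (Pr-joint r _))
    (𝔼-*-mono (pow₂ e) (Supported-weaken (λ {st} _ → given st) (extending-runRows (before r) [])))
    where
    rest : St → Dist St
    rest = runRows (fromOn r)
    given : ∀ st → 𝔼 (rest st) (λ fin → 𝟙 (isSurvivor (ι r) j fin ∧ Q st)) * pow₂ e
                     ≤ 𝔼 (rest st) (λ fin → 𝟙 (nonCompact (ι r) j fin ∧ Q st))
    given st with Q st
    ... | true = subst₂ (λ u v → u * pow₂ e ≤ v)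
                   (𝔼-cong (rest st) λ fin → cong 𝟙 (sym (∧-identityʳ (isSurvivor (ι r) j fin))))
                   (𝔼-cong (rest st) λ fin → cong 𝟙 (sym (∧-identityʳ (nonCompact (ι r) j fin))))
                   (survivalBound-runRows (ι r) j (fromOn r) (ι∈fromOn r) st)
    ... | false = subst₂ (λ u v → u * pow₂ e ≤ v) (sym (vanishes isSurvivor)) (sym (vanishes nonCompact))
                   (ℚ.≤-reflexive (ℚ.*-zeroˡ (pow₂ e)))
      where
      vanishes : (P : Bits k → Bits k → St → Bool) → 𝔼 (rest st) (λ fin → 𝟙 (P (ι r) j fin ∧ false)) ≡ 0ℚ
      vanishes P = 𝔼-vanishes
        (Supported-weaken (λ {fin} _ → cong 𝟙 (∧-zeroʳ (P (ι r) j fin))) (extending-runRows (fromOn r) st))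

proposition5p8 : (k d e : ℕ) (mul : Bits k → Bits k → Bits k) (one : Bits k) →
    IsGF k mul one →
    (ι : Fin (2 ^ k) ⤖ Bits k) →
    let open Procedure d e mul one (Bijection.to ι) in
    (r : Fin (2 ^ k)) (j : Bits k) →
      (Pr (joint r) (λ { (st , fin) → survives fin (Bijection.to ι r) j ∧ not (compact fin (Bijection.to ι r)) })
         * ((+ (2 ^ e)) / 1)
       ≤ Pr (joint r) (λ { (st , fin) → not (compact fin (Bijection.to ι r)) }))
    × ((A : Big k d → Bool) →
      Pr (joint r) (λ { (st , fin) → survives fin (Bijection.to ι r) j ∧ not (compact fin (Bijection.to ι r)) ∧ sameSet st A })
         * ((+ (2 ^ e)) / 1)
       ≤ Pr (joint r) (λ { (st , fin) → not (compact fin (Bijection.to ι r)) ∧ sameSet st A }))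
proposition5p8 k d e mul one gf ι r j =
  subst₂ (λ u v → u * pow₂ e ≤ v)
    (Pr-cong (joint r) λ (_ , fin) → ∧-identityʳ (isSurvivor a j fin))
    (Pr-cong (joint r) λ (_ , fin) → ∧-identityʳ (nonCompact a j fin))
    (survivalBound-joint r j (λ _ → true)) ,
  λ A → subst₂ (λ u v → u * pow₂ e ≤ v)
    (Pr-cong (joint r) λ (st , fin) → ∧-assoc (survives fin a j) (nonCompact a j fin) (sameSet st A))
    refl
    (survivalBound-joint r j (λ st → sameSet st A))
  where
  open Procedure d e mul one (Bijection.to ι)
  open Survival d e gf (Bijection.to ι)
  a : Bits k
  a = Bijection.to ι r
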